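{- Let $M=(m_{ij}:i,j\in V)$ be a skew-symmetric or symmetric $V\times V$ matrix over a field $\mathbb{F}$. Let $a,b$ be supplementary chains on $V$ to $K=\mathbb{F}^2$, where $\langle\,,\,\rangle_K$ is skew-symmetric if $M$ is symmetric and symmetric if $M$ is skew-symmetric. For $i\in V$ let $f_i$ be the chain on $V$ to $K$ with $f_i(j)=m_{ij}a(j)+b(j)$ if $j=i$ and $f_i(j)=m_{ij}a(j)$ if $j\ne i$. Then the subspace $N$ of $K^V$ spanned by $\{f_i:i\in V\}$ is a Lagrangian chain-group on $V$ to $K$.
   Context: Skew-symmetric: $M=-M^t$ with zero diagonal; symmetric: $M=M^t$. The forms on $K$ are $b^+(\binom ab,\binom cd)=ad+bc$ (symmetric) and $b^-(\binom ab,\binom cd)=ad-bc$ (skew-symmetric). A chain on $V$ to $K$ is a map $V\to K$; $K^V$ has the bilinear form $\langle f,g\rangle=\sum_x\langle f(x),g(x)\rangle_K$. Chains $a,b$ are supplementary if $\langle a(x),a(x)\rangle_K=\langle b(x),b(x)\rangle_K=0$ and $\langle a(x),b(x)\rangle_K=1$ for all $x\in V$. A chain-group is a subspace of $K^V$; it is Lagrangian if $\langle f,g\rangle=0$ for all $f,g$ in it and its dimension is $|V|$. -}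

module Defs where

open import Level using (Level; _⊔_; suc)
open import Algebra.Bundles using (CommutativeRing)
open import Data.Nat using (ℕ; zero) renaming (suc to sucℕ)
open import Data.Fin using (Fin) renaming (zero to fz; suc to fs)
open import Data.Product using (Σ; ∃; _×_; _,_)
open import Relation.Nullary using (¬_)

record Field (c ℓ : Level) : Set (suc (c ⊔ ℓ)) where
  field
    commutativeRing : CommutativeRing c ℓ
  open CommutativeRing commutativeRing public
  field
    0≉1     : ¬ (0# ≈ 1#)
    inverse : ∀ x → ¬ (x ≈ 0#) → Σ Carrier λ y → x * y ≈ 1#

data Kind : Set where
  symmetric skew : Kind

opposite : Kind → Kind
opposite symmetric = skew
opposite skew      = symmetric

module _ {c ℓ : Level} (𝔽 : Field c ℓ) where
  open Field 𝔽

  ∑ : ∀ {n} → (Fin n → Carrier) → Carrier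
  ∑ {zero}   f = 0#
  ∑ {sucℕ n} f = f fz + ∑ (λ i → f (fs i))

  K : Set c
  K = Carrier × Carrier

  _≈K_ : K → K → Set ℓ
  (a , b) ≈K (c' , d) = (a ≈ c') × (b ≈ d)

  _·K_ : Carrier → K → K
  λ' ·K (a , b) = (λ' * a , λ' * b)

  _+K_ : K → K → K
  (a , b) +K (c' , d) = (a + c' , b + d)

  0K : K
  0K = (0# , 0#)

  formK : Kind → K → K → Carrier
  formK symmetric (a , b) (c' , d) = a * d + b * c'
  formK skew      (a , b) (c' , d) = a * d - b * c'

  Matrix : ℕ → Set c
  Matrix n = Fin n → Fin n → Carrier

  IsOfKind : ∀ {n} → Kind → Matrix n → Set ℓ
  IsOfKind symmetric M = ∀ i j → M i j ≈ M j i
  IsOfKind skew      M = (∀ i j → M i j ≈ - M j i) × (∀ i → M i i ≈ 0#)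

  Chain : ℕ → Set c
  Chain n = Fin n → K

  chainForm : ∀ {n} → Kind → Chain n → Chain n → Carrier
  chainForm κ f g = ∑ (λ x → formK κ (f x) (g x))

  Supplementary : ∀ {n} → Kind → Chain n → Chain n → Set ℓ
  Supplementary κ a b = ∀ x →
    (formK κ (a x) (a x) ≈ 0#) × (formK κ (b x) (b x) ≈ 0#) × (formK κ (a x) (b x) ≈ 1#)

  linComb : ∀ {n k} → (Fin k → Carrier) → (Fin k → Chain n) → Chain n
  linComb {k = zero}   cs u x = 0K
  linComb {k = sucℕ k} cs u x =
    (cs fz ·K u fz x) +K linComb (λ i → cs (fs i)) (λ i → u (fs i)) x

  _≈C_ : ∀ {n} → Chain n → Chain n → Set ℓ
  f ≈C g = ∀ x → f x ≈K g x

  Span : ∀ {n k} → (Fin k → Chain n) → Chain n → Set (c ⊔ ℓ)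
  Span u g = ∃ λ cs → g ≈C linComb cs u

  LinearlyIndependent : ∀ {n k} → (Fin k → Chain n) → Set (c ⊔ ℓ)
  LinearlyIndependent u = ∀ cs → linComb cs u ≈C (λ _ → 0K) → ∀ i → cs i ≈ 0#

  HasDimension : ∀ {n} → (Chain n → Set (c ⊔ ℓ)) → ℕ → Set (c ⊔ ℓ)
  HasDimension N d = ∃ λ (u : Fin d → Chain _) →
    (∀ i → N (u i)) × LinearlyIndependent u × (∀ g → N g → Span u g)

  IsLagrangian : ∀ {n} → Kind → (Chain n → Set (c ⊔ ℓ)) → Set (c ⊔ ℓ)
  IsLagrangian {n} κ N =
    (∀ f g → N f → N g → chainForm κ f g ≈ 0#) × HasDimension N n

  fChain : ∀ {n} → Matrix n → Chain n → Chain n → Fin n → Chain n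
  fChain M a b i j with i Data.Fin.≟ j
  ... | Relation.Nullary.yes _ = (M i j ·K a j) +K b j
  ... | Relation.Nullary.no  _ = M i j ·K a j

module Submission where

-- Write ε for the sign of the form on K (ε = 1 for b⁺,
-- ε = -1 for b⁻), so that ⟨y,x⟩ = ε⟨x,y⟩ and ⟨(a,b),(c,d)⟩ = ad + ε·bc.
-- With δ the Kronecker delta, f_i(j) = m_ij·a(j) + δ_ij·b(j).  Since a and b
-- are supplementary, expanding bilinearly gives
--   ⟨f_i(j), f_k(j)⟩ = ε·δ_ij·m_kj + δ_kj·m_ij ,  hence  ⟨f_i,f_k⟩ = ε·m_ki + m_ik,
-- which vanishes because the kind of M is opposite to that of the form.
-- Likewise ⟨a(x), f_j(x)⟩ = δ_jx, so x ↦ ⟨a(x), -⟩ reads off coefficient x of a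
-- linear combination of the f_j: the f_j are linearly independent.

open import Defs
open import Level using (Level)
open import Data.Nat using (ℕ; zero; suc)
open import Data.Fin using (Fin; _≟_) renaming (zero to fz; suc to fs)
open import Data.Product using (_,_; proj₁; proj₂)
open import Data.Empty using (⊥-elim)
open import Relation.Nullary using (¬_; yes; no)
open import Relation.Binary.PropositionalEquality as P using (_≡_)
open import Algebra.Bundles using (CommutativeRing)
import Algebra.Solver.Ring.NaturalCoefficients.Default as RingSolver
import Algebra.Properties.Ring as RingProperties
import Algebra.Properties.Group as GroupProperties
import Algebra.Properties.CommutativeSemigroup as CommutativeSemigroupProperties
import Relation.Binary.Reasoning.Setoid as SetoidReasoning

module Development {c ℓ : Level} (𝔽 : Field c ℓ) where
  open Field 𝔽
  open RingSolver (CommutativeRing.commutativeSemiring commutativeRing)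
    using (solve; _:=_; _:+_; _:*_; con)
  open RingProperties ring using (-1*x≈-x)
  open GroupProperties (CommutativeRing.+-group commutativeRing) using (⁻¹-involutive)
  open CommutativeSemigroupProperties (CommutativeRing.*-commutativeSemigroup commutativeRing)
    using (x∙yz≈y∙xz)
  open SetoidReasoning setoid

  form : Kind → K 𝔽 → K 𝔽 → Carrier
  form = formK 𝔽

  ⟨_∣_⟩[_] : ∀ {n} → Chain 𝔽 n → Chain 𝔽 n → Kind → Carrier
  ⟨ f ∣ g ⟩[ κ ] = chainForm 𝔽 κ f g

  sign : Kind → Carrier
  sign symmetric = 1#
  sign skew      = - 1#

  sign²≈1 : ∀ κ → sign κ * sign κ ≈ 1#
  sign²≈1 symmetric = *-identityˡ 1#
  sign²≈1 skew      = trans (-1*x≈-x (- 1#)) (⁻¹-involutive 1#)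

  -- Both forms in one normal shape; every identity about forms on K below
  -- is reduced to it and then closed by ring normalisation.
  form-normal : ∀ κ x₁ x₂ y₁ y₂ → form κ (x₁ , x₂) (y₁ , y₂) ≈ x₁ * y₂ + sign κ * (x₂ * y₁)
  form-normal symmetric _ _ _ _ = +-cong refl (sym (*-identityˡ _))
  form-normal skew      _ _ _ _ = +-cong refl (sym (-1*x≈-x _))

  form-cong : ∀ κ {x x′ y y′} → _≈K_ 𝔽 x x′ → _≈K_ 𝔽 y y′ → form κ x y ≈ form κ x′ y′
  form-cong symmetric (p₁ , p₂) (q₁ , q₂) = +-cong (*-cong p₁ q₂) (*-cong p₂ q₁)
  form-cong skew      (p₁ , p₂) (q₁ , q₂) = +-cong (*-cong p₁ q₂) (-‿cong (*-cong p₂ q₁))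

  form-transpose : ∀ κ x y → form κ y x ≈ sign κ * form κ x y
  form-transpose κ (x₁ , x₂) (y₁ , y₂) = begin
    form κ (y₁ , y₂) (x₁ , x₂)               ≈⟨ form-normal κ _ _ _ _ ⟩
    y₁ * x₂ + ε * (y₂ * x₁)                  ≈⟨ solve 5 (λ e x₁ x₂ y₁ y₂ →
                                                   y₁ :* x₂ :+ e :* (y₂ :* x₁)
                                                   := e :* (x₁ :* y₂) :+ con 1 :* (x₂ :* y₁))
                                                 refl ε x₁ x₂ y₁ y₂ ⟩
    ε * (x₁ * y₂) + 1# * (x₂ * y₁)           ≈⟨ +-cong refl (*-cong (sym (sign²≈1 κ)) refl) ⟩
    ε * (x₁ * y₂) + (ε * ε) * (x₂ * y₁)      ≈⟨ solve 5 (λ e x₁ x₂ y₁ y₂ →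
                                                   e :* (x₁ :* y₂) :+ (e :* e) :* (x₂ :* y₁)
                                                   := e :* (x₁ :* y₂ :+ e :* (x₂ :* y₁)))
                                                 refl ε x₁ x₂ y₁ y₂ ⟩
    ε * (x₁ * y₂ + ε * (x₂ * y₁))            ≈⟨ *-cong refl (sym (form-normal κ _ _ _ _)) ⟩
    ε * form κ (x₁ , x₂) (y₁ , y₂)           ∎
    where ε = sign κ

  form-+ʳ : ∀ κ x y z → form κ x (_+K_ 𝔽 y z) ≈ form κ x y + form κ x z
  form-+ʳ κ (x₁ , x₂) (y₁ , y₂) (z₁ , z₂) =
    trans (form-normal κ _ _ _ _) (trans
      (solve 7 (λ e x₁ x₂ y₁ y₂ z₁ z₂ →
         x₁ :* (y₂ :+ z₂) :+ e :* (x₂ :* (y₁ :+ z₁))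
         := (x₁ :* y₂ :+ e :* (x₂ :* y₁)) :+ (x₁ :* z₂ :+ e :* (x₂ :* z₁)))
       refl (sign κ) x₁ x₂ y₁ y₂ z₁ z₂)
      (sym (+-cong (form-normal κ _ _ _ _) (form-normal κ _ _ _ _))))

  form-·ʳ : ∀ κ λ′ x z → form κ x (_·K_ 𝔽 λ′ z) ≈ λ′ * form κ x z
  form-·ʳ κ λ′ (x₁ , x₂) (z₁ , z₂) =
    trans (form-normal κ _ _ _ _) (trans
      (solve 6 (λ e l x₁ x₂ z₁ z₂ →
         x₁ :* (l :* z₂) :+ e :* (x₂ :* (l :* z₁)) := l :* (x₁ :* z₂ :+ e :* (x₂ :* z₁)))
       refl (sign κ) λ′ x₁ x₂ z₁ z₂)
      (sym (*-cong refl (form-normal κ _ _ _ _))))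

  form-0ʳ : ∀ κ x → form κ x (0K 𝔽) ≈ 0#
  form-0ʳ κ (x₁ , x₂) = trans (form-normal κ _ _ _ _)
    (solve 3 (λ e x₁ x₂ → x₁ :* con 0 :+ e :* (x₂ :* con 0) := con 0) refl (sign κ) x₁ x₂)

  form-+ˡ : ∀ κ x y z → form κ (_+K_ 𝔽 x y) z ≈ form κ x z + form κ y z
  form-+ˡ κ x y z = begin
    form κ (_+K_ 𝔽 x y) z                       ≈⟨ form-transpose κ z _ ⟩
    sign κ * form κ z (_+K_ 𝔽 x y)              ≈⟨ *-cong refl (form-+ʳ κ z x y) ⟩
    sign κ * (form κ z x + form κ z y)          ≈⟨ distribˡ _ _ _ ⟩
    sign κ * form κ z x + sign κ * form κ z y   ≈⟨ +-cong (sym (form-transpose κ z x))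
                                                          (sym (form-transpose κ z y)) ⟩
    form κ x z + form κ y z                     ∎

  form-·ˡ : ∀ κ λ′ x z → form κ (_·K_ 𝔽 λ′ x) z ≈ λ′ * form κ x z
  form-·ˡ κ λ′ x z = begin
    form κ (_·K_ 𝔽 λ′ x) z        ≈⟨ form-transpose κ z _ ⟩
    sign κ * form κ z (_·K_ 𝔽 λ′ x) ≈⟨ *-cong refl (form-·ʳ κ λ′ z x) ⟩
    sign κ * (λ′ * form κ z x)    ≈⟨ x∙yz≈y∙xz _ _ _ ⟩
    λ′ * (sign κ * form κ z x)    ≈⟨ *-cong refl (sym (form-transpose κ z x)) ⟩
    λ′ * form κ x z               ∎

  form-0ˡ : ∀ κ z → form κ (0K 𝔽) z ≈ 0#
  form-0ˡ κ z = trans (form-transpose κ z _) (trans (*-cong refl (form-0ʳ κ z)) (zeroʳ _))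

  form-expand : ∀ κ m m′ s t x y →
    form κ (_+K_ 𝔽 (_·K_ 𝔽 m x) (_·K_ 𝔽 s y)) (_+K_ 𝔽 (_·K_ 𝔽 m′ x) (_·K_ 𝔽 t y))
    ≈ ((m * m′) * form κ x x + (m * t) * form κ x y)
      + ((s * m′) * form κ y x + (s * t) * form κ y y)
  form-expand κ m m′ s t (x₁ , x₂) (y₁ , y₂) =
    trans (form-normal κ _ _ _ _) (trans
      (solve 9 (λ e m m′ s t x₁ x₂ y₁ y₂ →
         (m :* x₁ :+ s :* y₁) :* (m′ :* x₂ :+ t :* y₂)
           :+ e :* ((m :* x₂ :+ s :* y₂) :* (m′ :* x₁ :+ t :* y₁))
         := ((m :* m′) :* (x₁ :* x₂ :+ e :* (x₂ :* x₁)) :+ (m :* t) :* (x₁ :* y₂ :+ e :* (x₂ :* y₁)))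
            :+ ((s :* m′) :* (y₁ :* x₂ :+ e :* (y₂ :* x₁)) :+ (s :* t) :* (y₁ :* y₂ :+ e :* (y₂ :* y₁))))
       refl (sign κ) m m′ s t x₁ x₂ y₁ y₂)
      (sym (+-cong (+-cong (*-cong refl (form-normal κ _ _ _ _)) (*-cong refl (form-normal κ _ _ _ _)))
                   (+-cong (*-cong refl (form-normal κ _ _ _ _)) (*-cong refl (form-normal κ _ _ _ _))))))

  ∑-cong : ∀ {n} {f g : Fin n → Carrier} → (∀ i → f i ≈ g i) → ∑ 𝔽 f ≈ ∑ 𝔽 g
  ∑-cong {zero}  p = refl
  ∑-cong {suc n} p = +-cong (p fz) (∑-cong (λ i → p (fs i)))

  ∑-+ : ∀ {n} (f g : Fin n → Carrier) → ∑ 𝔽 (λ i → f i + g i) ≈ ∑ 𝔽 f + ∑ 𝔽 g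
  ∑-+ {zero}  f g = sym (+-identityˡ 0#)
  ∑-+ {suc n} f g = trans (+-cong refl (∑-+ (λ i → f (fs i)) (λ i → g (fs i))))
    (solve 4 (λ a b c d → (a :+ b) :+ (c :+ d) := (a :+ c) :+ (b :+ d)) refl _ _ _ _)

  ∑-* : ∀ {n} λ′ (f : Fin n → Carrier) → ∑ 𝔽 (λ i → λ′ * f i) ≈ λ′ * ∑ 𝔽 f
  ∑-* {zero}  λ′ f = sym (zeroʳ λ′)
  ∑-* {suc n} λ′ f = trans (+-cong refl (∑-* λ′ (λ i → f (fs i)))) (sym (distribˡ λ′ _ _))

  ∑-0 : ∀ {n} (f : Fin n → Carrier) → (∀ i → f i ≈ 0#) → ∑ 𝔽 f ≈ 0#
  ∑-0 {zero}  f p = refl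
  ∑-0 {suc n} f p = trans (+-cong (p fz) (∑-0 (λ i → f (fs i)) (λ i → p (fs i)))) (+-identityˡ 0#)

  δ : ∀ {k} → Fin k → Fin k → Carrier
  δ fz     fz     = 1#
  δ fz     (fs _) = 0#
  δ (fs _) fz     = 0#
  δ (fs i) (fs j) = δ i j

  δ-diag : ∀ {k} (i : Fin k) → δ i i ≈ 1#
  δ-diag fz     = refl
  δ-diag (fs i) = δ-diag i

  δ-off : ∀ {k} (i j : Fin k) → ¬ (i ≡ j) → δ i j ≈ 0#
  δ-off fz     fz     i≢j = ⊥-elim (i≢j P.refl)
  δ-off fz     (fs j) i≢j = refl
  δ-off (fs i) fz     i≢j = refl
  δ-off (fs i) (fs j) i≢j = δ-off i j (λ i≡j → i≢j (P.cong fs i≡j))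

  δ-sym : ∀ {k} (i j : Fin k) → δ i j ≈ δ j i
  δ-sym fz     fz     = refl
  δ-sym fz     (fs j) = refl
  δ-sym (fs i) fz     = refl
  δ-sym (fs i) (fs j) = δ-sym i j

  ∑-δ : ∀ {n} (i : Fin n) (g : Fin n → Carrier) → ∑ 𝔽 (λ j → δ i j * g j) ≈ g i
  ∑-δ fz     g = trans (+-cong (*-identityˡ _) (∑-0 (λ j → 0# * g (fs j)) (λ j → zeroˡ _)))
                       (+-identityʳ _)
  ∑-δ (fs i) g = trans (+-cong (zeroˡ _) (∑-δ i (λ j → g (fs j)))) (+-identityˡ _)

  linComb-0 : ∀ {n k} (u : Fin k → Chain 𝔽 n) x → _≈K_ 𝔽 (linComb 𝔽 (λ _ → 0#) u x) (0K 𝔽)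
  linComb-0 {k = zero}  u x = refl , refl
  linComb-0 {k = suc k} u x with linComb-0 (λ i → u (fs i)) x
  ... | p₁ , p₂ = trans (+-cong (zeroˡ _) p₁) (+-identityˡ _) ,
                  trans (+-cong (zeroˡ _) p₂) (+-identityˡ _)

  linComb-δ : ∀ {n k} (u : Fin k → Chain 𝔽 n) (i : Fin k) x → _≈K_ 𝔽 (linComb 𝔽 (δ i) u x) (u i x)
  linComb-δ u fz x with linComb-0 (λ i → u (fs i)) x
  ... | p₁ , p₂ = trans (+-cong (*-identityˡ _) p₁) (+-identityʳ _) ,
                  trans (+-cong (*-identityˡ _) p₂) (+-identityʳ _)
  linComb-δ u (fs i) x with linComb-δ (λ j → u (fs j)) i x
  ... | p₁ , p₂ = trans (+-cong (zeroˡ _) p₁) (+-identityˡ _) ,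
                  trans (+-cong (zeroˡ _) p₂) (+-identityˡ _)

  member-in-span : ∀ {n k} (u : Fin k → Chain 𝔽 n) i → Span 𝔽 u (u i)
  member-in-span u i = δ i , λ x → let p₁ , p₂ = linComb-δ u i x in sym p₁ , sym p₂

  form-linCombʳ : ∀ κ {n k} (cs : Fin k → Carrier) (u : Fin k → Chain 𝔽 n) x y →
    form κ y (linComb 𝔽 cs u x) ≈ ∑ 𝔽 (λ i → cs i * form κ y (u i x))
  form-linCombʳ κ {k = zero}  cs u x y = form-0ʳ κ y
  form-linCombʳ κ {k = suc k} cs u x y = trans (form-+ʳ κ y _ _)
    (+-cong (form-·ʳ κ _ _ _) (form-linCombʳ κ (λ i → cs (fs i)) (λ i → u (fs i)) x y))

  chainForm-linCombˡ : ∀ κ {n k} (cs : Fin k → Carrier) (u : Fin k → Chain 𝔽 n) (g : Chain 𝔽 n) →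
    ⟨ linComb 𝔽 cs u ∣ g ⟩[ κ ] ≈ ∑ 𝔽 (λ i → cs i * ⟨ u i ∣ g ⟩[ κ ])
  chainForm-linCombˡ κ {k = zero} cs u g = ∑-0 _ (λ x → form-0ˡ κ (g x))
  chainForm-linCombˡ κ {n} {suc k} cs u g = begin
    ∑ 𝔽 (λ x → form κ (_+K_ 𝔽 (_·K_ 𝔽 (cs fz) (u fz x)) (rest x)) (g x))
      ≈⟨ ∑-cong (λ x → trans (form-+ˡ κ _ _ (g x)) (+-cong (form-·ˡ κ _ _ (g x)) refl)) ⟩
    ∑ 𝔽 (λ x → cs fz * form κ (u fz x) (g x) + form κ (rest x) (g x))
      ≈⟨ ∑-+ (λ x → cs fz * form κ (u fz x) (g x)) (λ x → form κ (rest x) (g x)) ⟩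
    ∑ 𝔽 (λ x → cs fz * form κ (u fz x) (g x)) + ⟨ rest ∣ g ⟩[ κ ]
      ≈⟨ +-cong (∑-* (cs fz) (λ x → form κ (u fz x) (g x))) (chainForm-linCombˡ κ (λ i → cs (fs i)) (λ i → u (fs i)) g) ⟩
    cs fz * ⟨ u fz ∣ g ⟩[ κ ] + ∑ 𝔽 (λ i → cs (fs i) * ⟨ u (fs i) ∣ g ⟩[ κ ]) ∎
    where
    rest : Chain 𝔽 n
    rest = linComb 𝔽 (λ i → cs (fs i)) (λ i → u (fs i))

  chainForm-transpose : ∀ κ {n} (f g : Chain 𝔽 n) → ⟨ g ∣ f ⟩[ κ ] ≈ sign κ * ⟨ f ∣ g ⟩[ κ ]
  chainForm-transpose κ f g = trans (∑-cong (λ x → form-transpose κ (f x) (g x))) (∑-* (sign κ) (λ x → form κ (f x) (g x)))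

  orthogonal-to-span : ∀ κ {n k} (u : Fin k → Chain 𝔽 n) (g : Chain 𝔽 n) →
    (∀ i → ⟨ u i ∣ g ⟩[ κ ] ≈ 0#) → ∀ cs → ⟨ linComb 𝔽 cs u ∣ g ⟩[ κ ] ≈ 0#
  orthogonal-to-span κ u g u⊥g cs =
    trans (chainForm-linCombˡ κ cs u g) (∑-0 _ (λ i → trans (*-cong refl (u⊥g i)) (zeroʳ _)))

  span-isotropic : ∀ κ {n k} (u : Fin k → Chain 𝔽 n) → (∀ i j → ⟨ u i ∣ u j ⟩[ κ ] ≈ 0#) →
    ∀ f g → Span 𝔽 u f → Span 𝔽 u g → ⟨ f ∣ g ⟩[ κ ] ≈ 0#
  span-isotropic κ u u⊥u f g (cs , f≈) (ds , g≈) = begin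
    ⟨ f ∣ g ⟩[ κ ]                              ≈⟨ ∑-cong (λ x → form-cong κ (f≈ x) (g≈ x)) ⟩
    ⟨ linComb 𝔽 cs u ∣ linComb 𝔽 ds u ⟩[ κ ]    ≈⟨ orthogonal-to-span κ u _ uᵢ⊥span cs ⟩
    0#                                          ∎
    where
    uᵢ⊥span : ∀ i → ⟨ u i ∣ linComb 𝔽 ds u ⟩[ κ ] ≈ 0#
    uᵢ⊥span i = trans (chainForm-transpose κ (linComb 𝔽 ds u) (u i))
      (trans (*-cong refl (orthogonal-to-span κ u (u i) (λ j → u⊥u j i) ds)) (zeroʳ _))

  -- A family u_1..u_n of chains on V = Fin n admitting a pointwise dual chain w,
  -- ⟨w(x), u_j(x)⟩ = δ_jx, is linearly independent: pairing a combination with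
  -- w at the point i recovers its i-th coefficient.
  independent-if-pointwise-dual : ∀ κ {n} (u : Fin n → Chain 𝔽 n) (w : Chain 𝔽 n) →
    (∀ j x → form κ (w x) (u j x) ≈ δ j x) → LinearlyIndependent 𝔽 u
  independent-if-pointwise-dual κ u w dual cs Σcu≈0 i = begin
    cs i                                          ≈⟨ sym (∑-δ i cs) ⟩
    ∑ 𝔽 (λ j → δ i j * cs j)                      ≈⟨ ∑-cong (λ j → trans (*-comm _ _)
                                                       (*-cong refl (trans (δ-sym i j) (sym (dual j i))))) ⟩
    ∑ 𝔽 (λ j → cs j * form κ (w i) (u j i))        ≈⟨ sym (form-linCombʳ κ cs u i (w i)) ⟩
    form κ (w i) (linComb 𝔽 cs u i)               ≈⟨ form-cong κ (refl , refl) (Σcu≈0 i) ⟩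
    form κ (w i) (0K 𝔽)                            ≈⟨ form-0ʳ κ (w i) ⟩
    0#                                            ∎

  span-Lagrangian : ∀ κ {n} (u : Fin n → Chain 𝔽 n) →
    (∀ i j → ⟨ u i ∣ u j ⟩[ κ ] ≈ 0#) → LinearlyIndependent 𝔽 u → IsLagrangian 𝔽 κ (Span 𝔽 u)
  span-Lagrangian κ u u⊥u indep =
    span-isotropic κ u u⊥u , (u , member-in-span u , indep , λ _ g∈span → g∈span)

  fChain-decomposition : ∀ {n} (M : Matrix 𝔽 n) (a b : Chain 𝔽 n) i j →
    _≈K_ 𝔽 (fChain 𝔽 M a b i j) (_+K_ 𝔽 (_·K_ 𝔽 (M i j) (a j)) (_·K_ 𝔽 (δ i j) (b j)))
  fChain-decomposition M a b i j with i ≟ j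
  ... | yes P.refl = +-cong refl (sym δb≈b) , +-cong refl (sym δb≈b)
    where δb≈b : ∀ {y} → δ i i * y ≈ y
          δb≈b = trans (*-cong (δ-diag i) refl) (*-identityˡ _)
  ... | no i≢j = sym (+-absorb-δb) , sym (+-absorb-δb)
    where +-absorb-δb : ∀ {x y} → x + δ i j * y ≈ x
          +-absorb-δb = trans (+-cong refl (trans (*-cong (δ-off i j i≢j) refl) (zeroˡ _)))
                              (+-identityʳ _)

  opposite-kind-cancels : ∀ {n} κ (M : Matrix 𝔽 n) → IsOfKind 𝔽 κ M →
    ∀ i k → sign (opposite κ) * M k i + M i k ≈ 0#
  opposite-kind-cancels symmetric M sym-M i k = trans (+-cong (-1*x≈-x _) (sym-M i k)) (-‿inverseˡ _)
  opposite-kind-cancels skew M skew-M i k =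
    trans (+-cong (*-identityˡ _) (proj₁ skew-M i k)) (-‿inverseʳ _)

  module _ {n : ℕ} (κ : Kind) (M : Matrix 𝔽 n) (a b : Chain 𝔽 n)
           (supp : Supplementary 𝔽 κ a b) where

    private
      f : Fin n → Chain 𝔽 n
      f = fChain 𝔽 M a b

    fChain-form-at : ∀ i k j → form κ (f i j) (f k j) ≈ δ i j * (sign κ * M k j) + δ k j * M i j
    fChain-form-at i k j = begin
      form κ (f i j) (f k j)
        ≈⟨ form-cong κ (fChain-decomposition M a b i j) (fChain-decomposition M a b k j) ⟩
      form κ (_+K_ 𝔽 (_·K_ 𝔽 (M i j) (a j)) (_·K_ 𝔽 (δ i j) (b j)))
             (_+K_ 𝔽 (_·K_ 𝔽 (M k j) (a j)) (_·K_ 𝔽 (δ k j) (b j)))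
        ≈⟨ form-expand κ (M i j) (M k j) (δ i j) (δ k j) (a j) (b j) ⟩
      ((M i j * M k j) * form κ (a j) (a j) + (M i j * δ k j) * form κ (a j) (b j))
        + ((δ i j * M k j) * form κ (b j) (a j) + (δ i j * δ k j) * form κ (b j) (b j))
        ≈⟨ +-cong (+-cong (*-cong refl aa≈0) (*-cong refl ab≈1))
                  (+-cong (*-cong refl (trans (form-transpose κ (a j) (b j)) (*-cong refl ab≈1)))
                          (*-cong refl bb≈0)) ⟩
      ((M i j * M k j) * 0# + (M i j * δ k j) * 1#)
        + ((δ i j * M k j) * (sign κ * 1#) + (δ i j * δ k j) * 0#)
        ≈⟨ solve 5 (λ m m′ s t e → ((m :* m′) :* con 0 :+ (m :* t) :* con 1)
                                     :+ ((s :* m′) :* (e :* con 1) :+ (s :* t) :* con 0)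
                                   := s :* (e :* m′) :+ t :* m)
                   refl (M i j) (M k j) (δ i j) (δ k j) (sign κ) ⟩
      δ i j * (sign κ * M k j) + δ k j * M i j ∎
      where
      aa≈0 : form κ (a j) (a j) ≈ 0#
      aa≈0 = proj₁ (supp j)
      bb≈0 : form κ (b j) (b j) ≈ 0#
      bb≈0 = proj₁ (proj₂ (supp j))
      ab≈1 : form κ (a j) (b j) ≈ 1#
      ab≈1 = proj₂ (proj₂ (supp j))

    fChain-form : ∀ i k → ⟨ f i ∣ f k ⟩[ κ ] ≈ sign κ * M k i + M i k
    fChain-form i k = trans (∑-cong (fChain-form-at i k))
      (trans (∑-+ (λ j → δ i j * (sign κ * M k j)) (λ j → δ k j * M i j)) (+-cong (∑-δ i (λ j → sign κ * M k j)) (∑-δ k (M i))))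

    a-dual-to-fChain : ∀ j x → form κ (a x) (f j x) ≈ δ j x
    a-dual-to-fChain j x = begin
      form κ (a x) (f j x)
        ≈⟨ form-cong κ (refl , refl) (fChain-decomposition M a b j x) ⟩
      form κ (a x) (_+K_ 𝔽 (_·K_ 𝔽 (M j x) (a x)) (_·K_ 𝔽 (δ j x) (b x)))
        ≈⟨ trans (form-+ʳ κ (a x) _ _) (+-cong (form-·ʳ κ _ _ _) (form-·ʳ κ _ _ _)) ⟩
      M j x * form κ (a x) (a x) + δ j x * form κ (a x) (b x)
        ≈⟨ +-cong (*-cong refl (proj₁ (supp x))) (*-cong refl (proj₂ (proj₂ (supp x)))) ⟩
      M j x * 0# + δ j x * 1#
        ≈⟨ trans (+-cong (zeroʳ _) (*-identityʳ _)) (+-identityˡ _) ⟩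
      δ j x ∎

proposition4p1 : {c ℓ : Level} (𝔽 : Field c ℓ) (n : ℕ) (κ : Kind)
    (M : Matrix 𝔽 n) → IsOfKind 𝔽 κ M →
    (a b : Chain 𝔽 n) → Supplementary 𝔽 (opposite κ) a b →
    IsLagrangian 𝔽 (opposite κ) (Span 𝔽 (fChain 𝔽 M a b))
proposition4p1 𝔽 n κ M kind-M a b supp =
  span-Lagrangian κ′ f f-orthogonal
    (independent-if-pointwise-dual κ′ f a (a-dual-to-fChain κ′ M a b supp))
  where
  open Development 𝔽
  open Field 𝔽 using (_≈_; 0#; trans)

  κ′ : Kind
  κ′ = opposite κ

  f : Fin n → Chain 𝔽 n
  f = fChain 𝔽 M a b

  f-orthogonal : ∀ i k → ⟨ f i ∣ f k ⟩[ κ′ ] ≈ 0#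
  f-orthogonal i k = trans (fChain-form κ′ M a b supp i k) (opposite-kind-cancels κ M kind-M i k)
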